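{- Let $\beta>0$ and let $G$ be a $\beta$-graph on $n$ vertices. Then $G$ contains a subgraph $G'$ on at least $(1-\beta)n$ vertices such that $|N_{G'}(U)|\geq\frac{1-3\beta}{2\beta}|U|$ for every vertex set $U\subseteq V(G')$ of size at most $\beta n$.
   Context: All graphs are finite and simple. For a graph $H$ and $U\subseteq V(H)$, $N_{H}(U)=\{v\in V(H)\setminus U: v \text{ has a neighbor in } U \text{ in } H\}$. For $\beta>0$, a graph $G=(V,E)$ on $n$ vertices is a $\beta$-graph if every pair of disjoint vertex sets $A,B\subseteq V$ with $|A|,|B|\geq\beta n$ are connected by an edge. -}

module Defs where

open import Data.Nat using (ℕ; zero; suc)
open import Data.Bool using (Bool; true; false; _∧_; _∨_; not)
open import Data.Fin using (Fin; zero; suc)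
open import Data.Fin.Subset using (Subset; _∈_; _∉_; _⊆_; ∣_∣)
open import Data.Vec using (tabulate; lookup)
open import Data.Integer using (+_)
open import Data.Rational using (ℚ; _/_; _≤_; _<_; _*_; _-_; 0ℚ; 1ℚ)
open import Data.Product using (Σ; ∃; _×_; _,_)
open import Relation.Binary.PropositionalEquality using (_≡_)

ℕ→ℚ : ℕ → ℚ
ℕ→ℚ m = (+ m) / 1

record Graph (n : ℕ) : Set where
  field
    adj    : Fin n → Fin n → Bool
    sym    : ∀ u v → adj u v ≡ adj v u
    irrefl : ∀ v → adj v v ≡ false
open Graph public

anyFin : {n : ℕ} → (Fin n → Bool) → Bool
anyFin {zero}  p = false
anyFin {suc n} p = p zero ∨ anyFin (λ i → p (suc i))

-- membership as a Bool (Side = Bool, inside = true)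
_∈ᵇ_ : {n : ℕ} → Fin n → Subset n → Bool
v ∈ᵇ S = lookup S v

-- N_{G[W]}(U): vertices of W outside U having a neighbour in U,
-- where G[W] is the (induced) subgraph of G on vertex set W.
N[_∣_]_ : {n : ℕ} → Graph n → Subset n → Subset n → Subset n
N[ G ∣ W ] U = tabulate λ v →
  (v ∈ᵇ W) ∧ not (v ∈ᵇ U) ∧ anyFin (λ u → (u ∈ᵇ U) ∧ (u ∈ᵇ W) ∧ adj G v u)

Disjoint : {n : ℕ} → Subset n → Subset n → Set
Disjoint A B = ∀ x → x ∈ A → x ∉ B

IsBetaGraph : {n : ℕ} → ℚ → Graph n → Set
IsBetaGraph {n} β G =
  (A B : Subset n) → Disjoint A B →
  β * ℕ→ℚ n ≤ ℕ→ℚ ∣ A ∣ → β * ℕ→ℚ n ≤ ℕ→ℚ ∣ B ∣ →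
  Σ (Fin n) λ a → Σ (Fin n) λ b → a ∈ A × b ∈ B × adj G a b ≡ true

-- Take X as large as possible among the sets with |X| ≤ βn and 2β|N(X)| ≤ (1 − 3β)|X|, and
-- let G' = G − X, so |G'| ≥ (1 − β)n. If some small U ⊆ V(G') had 2β|N_{G'}(U)| < (1 − 3β)|U|,
-- then Y = X ∪ U would again satisfy 2β|N(Y)| ≤ (1 − 3β)|Y| and be strictly larger than X.
-- By maximality |Y| > βn, while |Y| ≤ 2βn; since such a U forces 1 − 3β > 0, the neighbourhood
-- bound then leaves at least βn vertices outside Y ∪ N(Y), and the β-graph property produces an
-- edge between them and Y, which is impossible.
module Submission where

open import Defs hiding (sym)
open import Data.Bool using (Bool; true; false; T; not)
open import Data.Bool.Properties using (T-≡; T-∧; T-∨)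
open import Data.Fin using (Fin; zero; suc)
open import Data.Fin.Subset using (Subset; _∈_; _∉_; _⊆_; ∣_∣; _∪_; _∩_; ∁; ⊤; ⊥; inside; outside)
open import Data.Fin.Subset.Properties
  using (_∈?_; ∈⊤; ∉⊥; ∣⊥∣≡0; ∣p∣≤n; ∣∁p∣≡n∸∣p∣; Empty-unique; anySubset?; p⊆q⇒∣p∣≤∣q∣;
         p⊆p∪q; q⊆p∪q; x∈p∪q⁺; x∈p∪q⁻; x∈p∩q⁻; x∈∁p⇒x∉p; x∉p⇒x∈∁p)
import Data.Integer as ℤ
import Data.Integer.Properties as ℤ
open import Data.Nat as ℕ using (ℕ; zero; suc)
import Data.Nat.Properties as ℕ
open import Data.Nat.Coprimality as Coprimality using (1-coprimeTo)
open import Data.Product using (Σ; ∃; _×_; _,_)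
open import Data.Rational
  using (ℚ; mkℚ; _+_; _-_; _*_; _≤_; _<_; 0ℚ; 1ℚ; *≤*; positive; nonNegative)
open import Data.Rational.Properties
import Data.Rational.Unnormalised as ℚᵘ
import Data.Rational.Unnormalised.Properties as ℚᵘ
open import Data.Rational.Solver using (module +-*-Solver)
import Data.Empty as Empty
open import Data.Sum using (inj₁; inj₂)
open import Data.Vec using ([]; _∷_)
open import Data.Vec.Properties using (lookup∘tabulate; []=⇒lookup; lookup⇒[]=)
open import Function using (_∘_)
open import Function.Bundles using (_⇔_; mk⇔; Equivalence)
open import Relation.Binary.PropositionalEquality using (_≡_; _≢_; refl; sym; trans; cong; subst; module ≡-Reasoning)
open import Relation.Nullary using (Dec; yes; no; ¬_)
open import Relation.Nullary.Decidable using (_×-dec_)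
open import Relation.Unary using (Pred; Decidable)

open Equivalence using (to; from)
open +-*-Solver

mkℚ-ℕ : ℕ → ℚ
mkℚ-ℕ m = mkℚ (ℤ.+ m) 0 (Coprimality.sym (1-coprimeTo m))

ℕ→ℚ≡mkℚ : ∀ m → ℕ→ℚ m ≡ mkℚ-ℕ m
ℕ→ℚ≡mkℚ m = normalize-coprime (Coprimality.sym (1-coprimeTo m))

ℕ→ℚ-homo-+ : ∀ a b → ℕ→ℚ (a ℕ.+ b) ≡ ℕ→ℚ a + ℕ→ℚ b
ℕ→ℚ-homo-+ a b rewrite ℕ→ℚ≡mkℚ a | ℕ→ℚ≡mkℚ b | ℕ→ℚ≡mkℚ (a ℕ.+ b) =
  toℚᵘ-injective (ℚᵘ.≃-trans (ℚᵘ.*≡* cross) (ℚᵘ.≃-sym (toℚᵘ-homo-+ (mkℚ-ℕ a) (mkℚ-ℕ b))))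
  where
  cross : ℤ.+ (a ℕ.+ b) ℤ.* ℤ.+ 1 ≡ (ℤ.+ a ℤ.* ℤ.+ 1 ℤ.+ ℤ.+ b ℤ.* ℤ.+ 1) ℤ.* ℤ.+ 1
  cross rewrite ℤ.*-identityʳ (ℤ.+ a) | ℤ.*-identityʳ (ℤ.+ b) | ℤ.*-identityʳ (ℤ.+ a ℤ.+ ℤ.+ b) = refl

ℕ→ℚ-homo-+₃ : ∀ a b c → ℕ→ℚ (a ℕ.+ b ℕ.+ c) ≡ ℕ→ℚ a + ℕ→ℚ b + ℕ→ℚ c
ℕ→ℚ-homo-+₃ a b c = trans (ℕ→ℚ-homo-+ (a ℕ.+ b) c) (cong (_+ ℕ→ℚ c) (ℕ→ℚ-homo-+ a b))

ℕ→ℚ-mono-≤ : ∀ {a b} → a ℕ.≤ b → ℕ→ℚ a ≤ ℕ→ℚ b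
ℕ→ℚ-mono-≤ {a} {b} a≤b rewrite ℕ→ℚ≡mkℚ a | ℕ→ℚ≡mkℚ b = *≤* (ℤ.*-monoʳ-≤-nonNeg (ℤ.+ 1) (ℤ.+≤+ a≤b))

ℕ→ℚ-nonNeg : ∀ m → 0ℚ ≤ ℕ→ℚ m
ℕ→ℚ-nonNeg m = ℕ→ℚ-mono-≤ {0} {m} ℕ.z≤n

p≤q⇒0≤q-p : ∀ {p q} → p ≤ q → 0ℚ ≤ q - p
p≤q⇒0≤q-p {p} {q} p≤q = begin
  0ℚ     ≡⟨ +-inverseʳ p ⟨
  p - p  ≤⟨ +-monoˡ-≤ _ p≤q ⟩
  q - p  ∎
  where open ≤-Reasoning

0≤q-p⇒p≤q : ∀ {p q} → 0ℚ ≤ q - p → p ≤ q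
0≤q-p⇒p≤q {p} {q} 0≤q-p = begin
  p            ≡⟨ +-identityˡ p ⟨
  0ℚ + p       ≤⟨ +-monoˡ-≤ p 0≤q-p ⟩
  (q - p) + p  ≡⟨ solve 2 (λ p q → (q :- p) :+ p := q) refl p q ⟩
  q            ∎
  where open ≤-Reasoning

0≤p*q : ∀ {p q} → 0ℚ ≤ p → 0ℚ ≤ q → 0ℚ ≤ p * q
0≤p*q {p} {q} 0≤p 0≤q =
  nonNegative⁻¹ (p * q) {{nonNeg*nonNeg⇒nonNeg p {{nonNegative 0≤p}} q {{nonNegative 0≤q}}}}

0<p*q⇒0<p : ∀ {p q} → 0ℚ ≤ q → 0ℚ < p * q → 0ℚ < p
0<p*q⇒0<p {p} {q} 0≤q 0<pq =
  *-cancelʳ-<-nonNeg q {{nonNegative 0≤q}} (subst (_< p * q) (sym (*-zeroˡ q)) 0<pq)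

complement-lower-bound : ∀ {p n a z} → n ≤ a + z → a ≤ p * n → (1ℚ - p) * n ≤ z
complement-lower-bound {p} {n} {a} {z} n≤a+z a≤pn = 0≤q-p⇒p≤q (begin
  0ℚ                           ≤⟨ +-mono-≤ (p≤q⇒0≤q-p n≤a+z) (p≤q⇒0≤q-p a≤pn) ⟩
  ((a + z) - n) + (p * n - a)  ≡⟨ solve 4 (λ p n a z → ((a :+ z) :- n) :+ (p :* n :- a)
                                    := z :- (con 1ℚ :- p) :* n) refl p n a z ⟩
  z - (1ℚ - p) * n             ∎)
  where open ≤-Reasoning

0<p⇒0<2p : ∀ {p} → 0ℚ < p → 0ℚ < ℕ→ℚ 2 * p
0<p⇒0<2p {p} 0<p = subst (0ℚ <_) (solve 1 (λ p → p :+ p := con (ℕ→ℚ 2) :* p) refl p) (+-mono-< 0<p 0<p)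

outside-closed-neighbourhood-large :
  ∀ {β n y m z} → 0ℚ < β → 0ℚ < 1ℚ - ℕ→ℚ 3 * β →
  y ≤ β * n + β * n → (ℕ→ℚ 2 * β) * m ≤ (1ℚ - ℕ→ℚ 3 * β) * y → n ≤ y + m + z → β * n ≤ z
outside-closed-neighbourhood-large {β} {n} {y} {m} {z} 0<β 0<1-3β y≤2βn few n≤y+m+z =
  0≤q-p⇒p≤q (*-cancelˡ-≤-pos (ℕ→ℚ 2 * β) {{positive 0<2β}} (begin
    ℕ→ℚ 2 * β * 0ℚ                               ≡⟨ *-zeroʳ (ℕ→ℚ 2 * β) ⟩
    0ℚ                                           ≤⟨ +-mono-≤ (+-mono-≤ (p≤q⇒0≤q-p few)
                                                                       (0≤p*q 0≤1-β (p≤q⇒0≤q-p y≤2βn)))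
                                                             (0≤p*q (<⇒≤ 0<2β) (p≤q⇒0≤q-p n≤y+m+z)) ⟩
    ((1ℚ - ℕ→ℚ 3 * β) * y - ℕ→ℚ 2 * β * m)
      + (1ℚ - β) * ((β * n + β * n) - y)
      + ℕ→ℚ 2 * β * ((y + m + z) - n)            ≡⟨ solve 5 (λ β n y m z →
                                                       ((con 1ℚ :- con (ℕ→ℚ 3) :* β) :* y :- con (ℕ→ℚ 2) :* β :* m)
                                                       :+ (con 1ℚ :- β) :* ((β :* n :+ β :* n) :- y)
                                                       :+ con (ℕ→ℚ 2) :* β :* ((y :+ m :+ z) :- n)
                                                       := con (ℕ→ℚ 2) :* β :* (z :- β :* n)) refl β n y m z ⟩
    ℕ→ℚ 2 * β * (z - β * n)                      ∎))
  where
  open ≤-Reasoning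
  0<2β : 0ℚ < ℕ→ℚ 2 * β
  0<2β = 0<p⇒0<2p 0<β
  0≤1-β : 0ℚ ≤ 1ℚ - β
  0≤1-β = subst (0ℚ ≤_)
                (solve 1 (λ β → (con 1ℚ :- con (ℕ→ℚ 3) :* β) :+ con (ℕ→ℚ 2) :* β := con 1ℚ :- β) refl β)
                (+-mono-≤ (<⇒≤ 0<1-3β) (<⇒≤ 0<2β))

∣p∪q∣+∣p∩q∣≡∣p∣+∣q∣ : ∀ {n} (p q : Subset n) → ∣ p ∪ q ∣ ℕ.+ ∣ p ∩ q ∣ ≡ ∣ p ∣ ℕ.+ ∣ q ∣
∣p∪q∣+∣p∩q∣≡∣p∣+∣q∣ []            []            = refl
∣p∪q∣+∣p∩q∣≡∣p∣+∣q∣ (inside  ∷ p) (inside  ∷ q) =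
  cong suc (trans (ℕ.+-suc ∣ p ∪ q ∣ ∣ p ∩ q ∣)
                  (trans (cong suc (∣p∪q∣+∣p∩q∣≡∣p∣+∣q∣ p q)) (sym (ℕ.+-suc ∣ p ∣ ∣ q ∣))))
∣p∪q∣+∣p∩q∣≡∣p∣+∣q∣ (inside  ∷ p) (outside ∷ q) = cong suc (∣p∪q∣+∣p∩q∣≡∣p∣+∣q∣ p q)
∣p∪q∣+∣p∩q∣≡∣p∣+∣q∣ (outside ∷ p) (inside  ∷ q) =
  trans (cong suc (∣p∪q∣+∣p∩q∣≡∣p∣+∣q∣ p q)) (sym (ℕ.+-suc ∣ p ∣ ∣ q ∣))
∣p∪q∣+∣p∩q∣≡∣p∣+∣q∣ (outside ∷ p) (outside ∷ q) = ∣p∪q∣+∣p∩q∣≡∣p∣+∣q∣ p q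

∣p∪q∣≤∣p∣+∣q∣ : ∀ {n} (p q : Subset n) → ∣ p ∪ q ∣ ℕ.≤ ∣ p ∣ ℕ.+ ∣ q ∣
∣p∪q∣≤∣p∣+∣q∣ p q = ℕ.≤-trans (ℕ.m≤m+n ∣ p ∪ q ∣ ∣ p ∩ q ∣) (ℕ.≤-reflexive (∣p∪q∣+∣p∩q∣≡∣p∣+∣q∣ p q))

Disjoint⇒∣p∪q∣≡∣p∣+∣q∣ : ∀ {n} {p q : Subset n} → Disjoint p q → ∣ p ∪ q ∣ ≡ ∣ p ∣ ℕ.+ ∣ q ∣
Disjoint⇒∣p∪q∣≡∣p∣+∣q∣ {n} {p} {q} p#q = begin
  ∣ p ∪ q ∣                   ≡⟨ ℕ.+-identityʳ _ ⟨
  ∣ p ∪ q ∣ ℕ.+ 0             ≡⟨ cong (∣ p ∪ q ∣ ℕ.+_) ∣p∩q∣≡0 ⟨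
  ∣ p ∪ q ∣ ℕ.+ ∣ p ∩ q ∣     ≡⟨ ∣p∪q∣+∣p∩q∣≡∣p∣+∣q∣ p q ⟩
  ∣ p ∣ ℕ.+ ∣ q ∣             ∎
  where
  open ≡-Reasoning
  p∩q-empty : ¬ ∃ λ x → x ∈ p ∩ q
  p∩q-empty (x , x∈p∩q) with x∈p∩q⁻ p q x∈p∩q
  ... | x∈p , x∈q = p#q x x∈p x∈q
  ∣p∩q∣≡0 : ∣ p ∩ q ∣ ≡ 0
  ∣p∩q∣≡0 = trans (cong ∣_∣ (Empty-unique p∩q-empty)) (∣⊥∣≡0 n)

∣p∣+∣∁p∣≡n : ∀ {n} (p : Subset n) → ∣ p ∣ ℕ.+ ∣ ∁ p ∣ ≡ n
∣p∣+∣∁p∣≡n p = trans (cong (∣ p ∣ ℕ.+_) (∣∁p∣≡n∸∣p∣ p)) (ℕ.m+[n∸m]≡n (∣p∣≤n p))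

Largest : ∀ {n ℓ} → Pred (Subset n) ℓ → Pred (Subset n) ℓ
Largest P X = P X × ∀ Y → P Y → ∣ Y ∣ ℕ.≤ ∣ X ∣

module _ {n ℓ} {P : Pred (Subset n) ℓ} (P? : Decidable P) where

  largest-above : ∀ k X → P X → n ℕ.≤ k ℕ.+ ∣ X ∣ → ∃ (Largest P)
  largest-above zero    X pX n≤∣X∣ = X , pX , λ Y _ → ℕ.≤-trans (∣p∣≤n Y) n≤∣X∣
  largest-above (suc k) X pX n≤k+1+∣X∣ with anySubset? (λ Y → P? Y ×-dec ∣ X ∣ ℕ.<? ∣ Y ∣)
  ... | yes (Y , pY , ∣X∣<∣Y∣) =
    largest-above k Y pY (ℕ.≤-trans n≤k+1+∣X∣ (ℕ.≤-trans (ℕ.≤-reflexive (sym (ℕ.+-suc k ∣ X ∣)))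
                                                         (ℕ.+-monoʳ-≤ k ∣X∣<∣Y∣)))
  ... | no ¬larger = X , pX , λ Y pY → ℕ.≮⇒≥ (λ ∣X∣<∣Y∣ → ¬larger (Y , pY , ∣X∣<∣Y∣))

  largest : ∀ X → P X → ∃ (Largest P)
  largest X pX = largest-above n X pX (ℕ.m≤m+n n ∣ X ∣)

∁-lower-bound : ∀ {β n} (X : Subset n) → ℕ→ℚ ∣ X ∣ ≤ β * ℕ→ℚ n → (1ℚ - β) * ℕ→ℚ n ≤ ℕ→ℚ ∣ ∁ X ∣
∁-lower-bound {β} {n} X ∣X∣≤βn = complement-lower-bound {β} n≤∣X∣+∣∁X∣ ∣X∣≤βn
  where
  n≤∣X∣+∣∁X∣ : ℕ→ℚ n ≤ ℕ→ℚ ∣ X ∣ + ℕ→ℚ ∣ ∁ X ∣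
  n≤∣X∣+∣∁X∣ = ≤-reflexive (trans (cong ℕ→ℚ (sym (∣p∣+∣∁p∣≡n X))) (ℕ→ℚ-homo-+ ∣ X ∣ ∣ ∁ X ∣))

∈⇔T : ∀ {n} {x : Fin n} {S : Subset n} → x ∈ S ⇔ T (x ∈ᵇ S)
∈⇔T {x = x} {S} = mk⇔ (from T-≡ ∘ []=⇒lookup) (lookup⇒[]= x S ∘ to T-≡)

T-not⇒∉ : ∀ {n} {x : Fin n} {S : Subset n} → T (not (x ∈ᵇ S)) → x ∉ S
T-not⇒∉ t x∈S = subst (T ∘ not) ([]=⇒lookup x∈S) t

∉⇒T-not : ∀ {n} {x : Fin n} {S : Subset n} → x ∉ S → T (not (x ∈ᵇ S))
∉⇒T-not {x = x} {S} x∉S with x ∈ᵇ S in x∈ᵇS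
... | true  = x∉S (lookup⇒[]= x S x∈ᵇS)
... | false = _

anyFin⁺ : ∀ {n} (p : Fin n → Bool) i → T (p i) → T (anyFin p)
anyFin⁺ p zero    t = from T-∨ (inj₁ t)
anyFin⁺ p (suc i) t = from T-∨ (inj₂ (anyFin⁺ (p ∘ suc) i t))

anyFin⁻ : ∀ {n} (p : Fin n → Bool) → T (anyFin p) → ∃ λ i → T (p i)
anyFin⁻ {suc n} p t with to T-∨ t
... | inj₁ t₀ = zero , t₀
... | inj₂ t₊ with anyFin⁻ (p ∘ suc) t₊
...   | i , tᵢ = suc i , tᵢ

N[_]_ : ∀ {n} → Graph n → Subset n → Subset n
N[ G ] X = N[ G ∣ ⊤ ] X

module _ {n : ℕ} (G : Graph n) where

  ∈N⁺ : ∀ {W U : Subset n} {v u} →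
        v ∈ W → v ∉ U → u ∈ U → u ∈ W → adj G v u ≡ true → v ∈ N[ G ∣ W ] U
  ∈N⁺ {v = v} {u = u} v∈W v∉U u∈U u∈W vu = from ∈⇔T (subst T (sym (lookup∘tabulate _ v))
    (from T-∧ (to ∈⇔T v∈W , from T-∧ (∉⇒T-not v∉U ,
      anyFin⁺ _ u (from T-∧ (to ∈⇔T u∈U , from T-∧ (to ∈⇔T u∈W , from T-≡ vu)))))))

  ∈N⁻ : ∀ W U {v} → v ∈ N[ G ∣ W ] U →
        v ∈ W × v ∉ U × ∃ λ u → u ∈ U × u ∈ W × adj G v u ≡ true
  ∈N⁻ W U {v} v∈N with to T-∧ (subst T (lookup∘tabulate _ v) (to ∈⇔T v∈N))
  ... | v∈W , rest with to T-∧ rest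
  ...   | v∉U , adjacent with anyFin⁻ _ adjacent
  ...     | u , tᵤ with to T-∧ tᵤ
  ...       | u∈U , rest′ with to T-∧ rest′
  ...         | u∈W , vu = from ∈⇔T v∈W , T-not⇒∉ v∉U , u , from ∈⇔T u∈U , from ∈⇔T u∈W , to T-≡ vu

  ∣N⊥∣≡0 : ∀ W → ∣ N[ G ∣ W ] ⊥ ∣ ≡ 0
  ∣N⊥∣≡0 W = trans (cong ∣_∣ (Empty-unique no-neighbour)) (∣⊥∣≡0 n)
    where
    no-neighbour : ¬ ∃ λ v → v ∈ N[ G ∣ W ] ⊥
    no-neighbour (v , v∈N) with ∈N⁻ W ⊥ v∈N
    ... | _ , _ , u , u∈⊥ , _ = ∉⊥ u∈⊥

  N-∪-⊆ : ∀ X U → N[ G ] (X ∪ U) ⊆ N[ G ] X ∪ N[ G ∣ ∁ X ] U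
  N-∪-⊆ X U v∈N with ∈N⁻ ⊤ (X ∪ U) v∈N
  ... | _ , v∉X∪U , u , u∈X∪U , _ , vu with u ∈? X | x∈p∪q⁻ X U u∈X∪U
  ...   | yes u∈X | _       = x∈p∪q⁺ (inj₁ (∈N⁺ ∈⊤ (v∉X∪U ∘ p⊆p∪q U) u∈X ∈⊤ vu))
  ...   | no  u∉X | inj₁ u∈X = Empty.⊥-elim (u∉X u∈X)
  ...   | no  u∉X | inj₂ u∈U =
    x∈p∪q⁺ (inj₂ (∈N⁺ (x∉p⇒x∈∁p (v∉X∪U ∘ p⊆p∪q U)) (v∉X∪U ∘ q⊆p∪q X U) u∈U (x∉p⇒x∈∁p u∉X) vu))

  neighbour∈Y∪N : ∀ Y {a b} → a ∈ Y → adj G a b ≡ true → b ∈ Y ∪ N[ G ] Y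
  neighbour∈Y∪N Y {a} {b} a∈Y ab with b ∈? Y
  ... | yes b∈Y = x∈p∪q⁺ (inj₁ b∈Y)
  ... | no  b∉Y = x∈p∪q⁺ (inj₂ (∈N⁺ ∈⊤ b∉Y a∈Y ∈⊤ (trans (Graph.sym G b a) ab)))

module _ {n : ℕ} (β : ℚ) (G : Graph n) where

  NonExpanding : Pred (Subset n) _
  NonExpanding X = ℕ→ℚ ∣ X ∣ ≤ β * ℕ→ℚ n
                 × ℕ→ℚ 2 * β * ℕ→ℚ ∣ N[ G ] X ∣ ≤ (1ℚ - ℕ→ℚ 3 * β) * ℕ→ℚ ∣ X ∣

  nonExpanding? : Decidable NonExpanding
  nonExpanding? X = (ℕ→ℚ ∣ X ∣ ≤? β * ℕ→ℚ n)
                ×-dec (ℕ→ℚ 2 * β * ℕ→ℚ ∣ N[ G ] X ∣ ≤? (1ℚ - ℕ→ℚ 3 * β) * ℕ→ℚ ∣ X ∣)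

  nonExpanding-⊥ : 0ℚ < β → NonExpanding ⊥
  nonExpanding-⊥ 0<β rewrite ∣⊥∣≡0 n | ∣N⊥∣≡0 G ⊤ =
    0≤p*q (<⇒≤ 0<β) (ℕ→ℚ-nonNeg n) ,
    ≤-reflexive (trans (*-zeroʳ (ℕ→ℚ 2 * β)) (sym (*-zeroʳ (1ℚ - ℕ→ℚ 3 * β))))

  few-neighbours-∪ : ∀ {X U} → 0ℚ < β → U ⊆ ∁ X →
    ℕ→ℚ 2 * β * ℕ→ℚ ∣ N[ G ] X ∣ ≤ (1ℚ - ℕ→ℚ 3 * β) * ℕ→ℚ ∣ X ∣ →
    ℕ→ℚ 2 * β * ℕ→ℚ ∣ N[ G ∣ ∁ X ] U ∣ ≤ (1ℚ - ℕ→ℚ 3 * β) * ℕ→ℚ ∣ U ∣ →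
    ℕ→ℚ 2 * β * ℕ→ℚ ∣ N[ G ] (X ∪ U) ∣ ≤ (1ℚ - ℕ→ℚ 3 * β) * ℕ→ℚ ∣ X ∪ U ∣
  few-neighbours-∪ {X} {U} 0<β U⊆∁X fewX fewU = begin
    d * ℕ→ℚ ∣ N[ G ] (X ∪ U) ∣                   ≤⟨ *-monoˡ-≤-nonNeg d {{nonNegative (<⇒≤ (0<p⇒0<2p 0<β))}}
                                                      (ℕ→ℚ-mono-≤ ∣N[X∪U]∣≤∣NX∣+∣NU∣) ⟩
    d * ℕ→ℚ (∣ NX ∣ ℕ.+ ∣ NU ∣)                 ≡⟨ cong (d *_) (ℕ→ℚ-homo-+ ∣ NX ∣ ∣ NU ∣) ⟩
    d * (ℕ→ℚ ∣ NX ∣ + ℕ→ℚ ∣ NU ∣)               ≡⟨ *-distribˡ-+ d _ _ ⟩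
    d * ℕ→ℚ ∣ NX ∣ + d * ℕ→ℚ ∣ NU ∣             ≤⟨ +-mono-≤ fewX fewU ⟩
    c * ℕ→ℚ ∣ X ∣ + c * ℕ→ℚ ∣ U ∣               ≡⟨ *-distribˡ-+ c _ _ ⟨
    c * (ℕ→ℚ ∣ X ∣ + ℕ→ℚ ∣ U ∣)                 ≡⟨ cong (c *_) (trans (cong ℕ→ℚ ∣X∪U∣≡∣X∣+∣U∣)
                                                                  (ℕ→ℚ-homo-+ ∣ X ∣ ∣ U ∣)) ⟨
    c * ℕ→ℚ ∣ X ∪ U ∣                            ∎
    where
    open ≤-Reasoning
    c d : ℚ
    c = 1ℚ - ℕ→ℚ 3 * β
    d = ℕ→ℚ 2 * β
    NX NU : Subset n
    NX = N[ G ] X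
    NU = N[ G ∣ ∁ X ] U
    ∣N[X∪U]∣≤∣NX∣+∣NU∣ : ∣ N[ G ] (X ∪ U) ∣ ℕ.≤ ∣ NX ∣ ℕ.+ ∣ NU ∣
    ∣N[X∪U]∣≤∣NX∣+∣NU∣ = ℕ.≤-trans (p⊆q⇒∣p∣≤∣q∣ (N-∪-⊆ G X U)) (∣p∪q∣≤∣p∣+∣q∣ NX NU)
    ∣X∪U∣≡∣X∣+∣U∣ : ∣ X ∪ U ∣ ≡ ∣ X ∣ ℕ.+ ∣ U ∣
    ∣X∪U∣≡∣X∣+∣U∣ = Disjoint⇒∣p∪q∣≡∣p∣+∣q∣ λ x x∈X x∈U → x∈∁p⇒x∉p (U⊆∁X x∈U) x∈X

  βGraph⇒∁[Y∪NY]-small : IsBetaGraph β G → ∀ Y → β * ℕ→ℚ n ≤ ℕ→ℚ ∣ Y ∣ →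
                         ¬ (β * ℕ→ℚ n ≤ ℕ→ℚ ∣ ∁ (Y ∪ N[ G ] Y) ∣)
  βGraph⇒∁[Y∪NY]-small βG Y βn≤∣Y∣ βn≤∣Z∣
    with βG Y (∁ (Y ∪ N[ G ] Y)) (λ x x∈Y x∈Z → x∈∁p⇒x∉p x∈Z (p⊆p∪q _ x∈Y)) βn≤∣Y∣ βn≤∣Z∣
  ... | a , b , a∈Y , b∈Z , ab = x∈∁p⇒x∉p b∈Z (neighbour∈Y∪N G Y a∈Y ab)

  n≤∣Y∣+∣NY∣+∣∁[Y∪NY]∣ : ∀ Y → ℕ→ℚ n ≤ ℕ→ℚ ∣ Y ∣ + ℕ→ℚ ∣ N[ G ] Y ∣ + ℕ→ℚ ∣ ∁ (Y ∪ N[ G ] Y) ∣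
  n≤∣Y∣+∣NY∣+∣∁[Y∪NY]∣ Y =
    subst (ℕ→ℚ n ≤_) (ℕ→ℚ-homo-+₃ ∣ Y ∣ ∣ NY ∣ (∣ ∁ (Y ∪ NY) ∣)) (ℕ→ℚ-mono-≤ (begin
    n                                     ≡⟨ ∣p∣+∣∁p∣≡n (Y ∪ NY) ⟨
    ∣ Y ∪ NY ∣ ℕ.+ ∣ ∁ (Y ∪ NY) ∣         ≤⟨ ℕ.+-monoˡ-≤ ∣ ∁ (Y ∪ NY) ∣ (∣p∪q∣≤∣p∣+∣q∣ Y NY) ⟩
    ∣ Y ∣ ℕ.+ ∣ NY ∣ ℕ.+ ∣ ∁ (Y ∪ NY) ∣   ∎))
    where
    open ℕ.≤-Reasoning
    NY : Subset n
    NY = N[ G ] Y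

  expands-outside-largest : 0ℚ < β → IsBetaGraph β G → ∀ {X} → Largest NonExpanding X →
    ∀ U → U ⊆ ∁ X → ℕ→ℚ ∣ U ∣ ≤ β * ℕ→ℚ n →
    (1ℚ - ℕ→ℚ 3 * β) * ℕ→ℚ ∣ U ∣ ≤ ℕ→ℚ 2 * β * ℕ→ℚ ∣ N[ G ∣ ∁ X ] U ∣
  expands-outside-largest 0<β βG {X} ((∣X∣≤βn , fewX) , X-largest) U U⊆∁X ∣U∣≤βn = ≮⇒≥ not-few
    where
    c d : ℚ
    c = 1ℚ - ℕ→ℚ 3 * β
    d = ℕ→ℚ 2 * β
    Y : Subset n
    Y = X ∪ U
    ∣Y∣≡∣X∣+∣U∣ : ∣ Y ∣ ≡ ∣ X ∣ ℕ.+ ∣ U ∣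
    ∣Y∣≡∣X∣+∣U∣ = Disjoint⇒∣p∪q∣≡∣p∣+∣q∣ λ x x∈X x∈U → x∈∁p⇒x∉p (U⊆∁X x∈U) x∈X
    ∣Y∣≤2βn : ℕ→ℚ ∣ Y ∣ ≤ β * ℕ→ℚ n + β * ℕ→ℚ n
    ∣Y∣≤2βn = subst (_≤ β * ℕ→ℚ n + β * ℕ→ℚ n)
                    (sym (trans (cong ℕ→ℚ ∣Y∣≡∣X∣+∣U∣) (ℕ→ℚ-homo-+ ∣ X ∣ ∣ U ∣)))
                    (+-mono-≤ ∣X∣≤βn ∣U∣≤βn)
    not-few : ¬ (d * ℕ→ℚ ∣ N[ G ∣ ∁ X ] U ∣ < c * ℕ→ℚ ∣ U ∣)
    not-few fewU = by-size (ℕ→ℚ ∣ Y ∣ ≤? β * ℕ→ℚ n)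
      where
      0<c∣U∣ : 0ℚ < c * ℕ→ℚ ∣ U ∣
      0<c∣U∣ = ≤-<-trans (0≤p*q (<⇒≤ (0<p⇒0<2p 0<β)) (ℕ→ℚ-nonNeg ∣ N[ G ∣ ∁ X ] U ∣)) fewU
      fewY : d * ℕ→ℚ ∣ N[ G ] Y ∣ ≤ c * ℕ→ℚ ∣ Y ∣
      fewY = few-neighbours-∪ 0<β U⊆∁X fewX (<⇒≤ fewU)
      ∣U∣≢0 : ∣ U ∣ ≢ 0
      ∣U∣≢0 ∣U∣≡0 =
        <-irrefl refl (subst (0ℚ <_) (trans (cong (λ k → c * ℕ→ℚ k) ∣U∣≡0) (*-zeroʳ c)) 0<c∣U∣)
      ∣X∣<∣Y∣ : ∣ X ∣ ℕ.< ∣ Y ∣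
      ∣X∣<∣Y∣ = subst (∣ X ∣ ℕ.<_) (sym ∣Y∣≡∣X∣+∣U∣) (ℕ.m<m+n ∣ X ∣ (ℕ.n≢0⇒n>0 ∣U∣≢0))
      by-size : Dec (ℕ→ℚ ∣ Y ∣ ≤ β * ℕ→ℚ n) → Empty.⊥
      by-size (yes ∣Y∣≤βn) = ℕ.<⇒≱ ∣X∣<∣Y∣ (X-largest Y (∣Y∣≤βn , fewY))
      by-size (no ∣Y∣≰βn) = βGraph⇒∁[Y∪NY]-small βG Y (<⇒≤ (≰⇒> ∣Y∣≰βn))
        (outside-closed-neighbourhood-large {y = ℕ→ℚ ∣ Y ∣} {ℕ→ℚ ∣ N[ G ] Y ∣}
          0<β (0<p*q⇒0<p (ℕ→ℚ-nonNeg ∣ U ∣) 0<c∣U∣) ∣Y∣≤2βn fewY (n≤∣Y∣+∣NY∣+∣∁[Y∪NY]∣ Y))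

lemma4p1 : (β : ℚ) → 0ℚ < β → (n : ℕ) → (G : Graph n) → IsBetaGraph β G →
    Σ (Subset n) λ W →
    ((1ℚ - β) * ℕ→ℚ n ≤ ℕ→ℚ ∣ W ∣)
    × ((U : Subset n) → U ⊆ W → ℕ→ℚ ∣ U ∣ ≤ β * ℕ→ℚ n →
    (1ℚ - (ℕ→ℚ 3) * β) * ℕ→ℚ ∣ U ∣ ≤ ((ℕ→ℚ 2) * β) * ℕ→ℚ ∣ N[ G ∣ W ] U ∣)
lemma4p1 β 0<β n G βG with largest (nonExpanding? β G) ⊥ (nonExpanding-⊥ β G 0<β)
... | X , X-largest@((∣X∣≤βn , _) , _) =
  ∁ X , ∁-lower-bound {β} X ∣X∣≤βn , expands-outside-largest β G 0<β βG X-largest
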